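{- Let $\mathbb{K}$ be a field of characteristic $\neq 2$ and $b\in\mathbb{K}$ with $b^4(1+16b)\neq 0$. The Kubert curve $\mathcal{EK}_b: Y^2=(X-4b)(X^2+X-4b)$ is birationally equivalent over $\mathbb{K}$ to the Edwards curve $x^2+y^2=1+dx^2y^2$ with $d=16b+1$. If $16b+1$ is not a square in $\mathbb{K}$, then this Edwards curve is complete.
   Context: An Edwards curve $x^2+y^2=1+dx^2y^2$ is called complete when $d$ is not a square in the base field. -}

module Defs where

open import Level using (Level; _⊔_) renaming (suc to lsuc)
open import Data.Nat.Base using (ℕ; zero; suc)
open import Data.Product using (Σ; ∃; _×_; _,_)
open import Relation.Nullary using (¬_)
open import Algebra.Bundles using (CommutativeRing)
open import Algebra.Morphism.Structures using (module RingMorphisms)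

record Field (c ℓ : Level) : Set (lsuc (c ⊔ ℓ)) where
  field
    commutativeRing : CommutativeRing c ℓ
  open CommutativeRing commutativeRing public
  field
    0≉1     : ¬ (0# ≈ 1#)
    inverse : ∀ x → ¬ (x ≈ 0#) → ∃ λ y → x * y ≈ 1#

module FieldOps {c ℓ} (K : Field c ℓ) where
  open Field K

  infixr 9 _·_
  fromℕ : ℕ → Carrier
  fromℕ zero    = 0#
  fromℕ (suc n) = 1# + fromℕ n

  _·_ : ℕ → Carrier → Carrier
  n · x = fromℕ n * x

  infixr 10 _^_
  _^_ : Carrier → ℕ → Carrier
  x ^ zero  = 1#
  x ^ suc n = x * (x ^ n)

  CharNot2 : Set ℓ
  CharNot2 = ¬ (1# + 1# ≈ 0#)

  IsSquare : Carrier → Set (c ⊔ ℓ)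
  IsSquare d = ∃ λ s → s * s ≈ d

-- Field extensions L / K: a field L with a ring homomorphism K → L
-- (automatically injective).

record Extension {c ℓ} (K : Field c ℓ) : Set (lsuc (c ⊔ ℓ)) where
  field
    L     : Field c ℓ
    ι     : Field.Carrier K → Field.Carrier L
    isHom : RingMorphisms.IsRingHomomorphism
              (Field.rawRing K) (Field.rawRing L) ι

infixl 6 _⊕_
infixl 7 _⊗_
data Expr {a} (A : Set a) : Set a where
  con     : A → Expr A
  X Y     : Expr A
  _⊕_ _⊗_ : Expr A → Expr A → Expr A
  ⊖_      : Expr A → Expr A

module _ {c ℓ} {K : Field c ℓ} (E : Extension K) where
  open Extension E
  open Field L

  eval : Expr (Field.Carrier K) → Carrier → Carrier → Carrier
  eval (con a)  x y = ι a
  eval X        x y = x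
  eval Y        x y = y
  eval (e ⊕ f)  x y = eval e x y + eval f x y
  eval (e ⊗ f)  x y = eval e x y * eval f x y
  eval (⊖ e)    x y = - eval e x y

record PlaneCurve {c ℓ} (K : Field c ℓ) : Set c where
  constructor _≐_
  field
    lhs rhs : Expr (Field.Carrier K)

module _ {c ℓ} {K : Field c ℓ} where

  OnCurve : PlaneCurve K → (E : Extension K) →
            Field.Carrier (Extension.L E) → Field.Carrier (Extension.L E) → Set ℓ
  OnCurve (f ≐ g) E x y = Field._≈_ (Extension.L E) (eval E f x y) (eval E g x y)

  -- A rational map A² ⇢ A² defined over K:
  --   (X , Y) ↦ (num₁ / den₁ , num₂ / den₂)
  record RationalMap : Set c where
    field
      num₁ den₁ num₂ den₂ : Expr (Field.Carrier K)

  -- "φ is defined at P = (x,y) and φ(P) = (x', y')", for L-points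
  Sends : RationalMap → (E : Extension K) →
          (x y x' y' : Field.Carrier (Extension.L E)) → Set ℓ
  Sends φ E x y x' y' =
    ¬ (eval E den₁ x y ≈ 0#) × ¬ (eval E den₂ x y ≈ 0#) ×
    (x' * eval E den₁ x y ≈ eval E num₁ x y) ×
    (y' * eval E den₂ x y ≈ eval E num₂ x y)
    where open RationalMap φ
          open Field (Extension.L E)

  -- ψ ∘ φ is the identity on C₁ (wherever defined), maps C₁ into C₂, and the
  -- composite is defined at some geometric point of C₁ (so φ, ψ ∘ φ are
  -- defined on a dense open subset of C₁).
  IsLeftInverseOn : PlaneCurve K → PlaneCurve K →
                    RationalMap → RationalMap → Set (lsuc (c ⊔ ℓ))
  IsLeftInverseOn C₁ C₂ φ ψ =
    (∀ (E : Extension K) x y x' y' →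
       OnCurve C₁ E x y → Sends φ E x y x' y' → OnCurve C₂ E x' y')
    ×
    (∀ (E : Extension K) x y x' y' x'' y'' →
       OnCurve C₁ E x y → Sends φ E x y x' y' → Sends ψ E x' y' x'' y'' →
       Field._≈_ (Extension.L E) x'' x × Field._≈_ (Extension.L E) y'' y)
    ×
    (∃ λ (E : Extension K) → ∃ λ x → ∃ λ y → ∃ λ x' → ∃ λ y' → ∃ λ x'' → ∃ λ y'' →
       OnCurve C₁ E x y × Sends φ E x y x' y' × Sends ψ E x' y' x'' y'')

  BirationallyEquivalent : PlaneCurve K → PlaneCurve K → Set (lsuc (c ⊔ ℓ))
  BirationallyEquivalent C₁ C₂ =
    ∃ λ (φ : RationalMap) → ∃ λ (ψ : RationalMap) →
      IsLeftInverseOn C₁ C₂ φ ψ × IsLeftInverseOn C₂ C₁ ψ φ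

module Curves {c ℓ} (K : Field c ℓ) where
  open Field K
  open FieldOps K

  Kubert : Carrier → PlaneCurve K
  Kubert b = (Y ⊗ Y) ≐ ((X ⊕ ⊖ con (4 · b)) ⊗ (X ⊗ X ⊕ X ⊕ ⊖ con (4 · b)))

  Edwards : Carrier → PlaneCurve K
  Edwards d = (X ⊗ X ⊕ Y ⊗ Y) ≐ (con 1# ⊕ con d ⊗ X ⊗ X ⊗ Y ⊗ Y)

  IsCompleteEdwards : Carrier → Set (c ⊔ ℓ)
  IsCompleteEdwards d = ¬ IsSquare d

{-# OPTIONS --safe #-}
module Submission where

-- With c = 4b the maps are φ(X , Y) = ((c - X) / Y , X / (X - 2c)) and
-- ψ(x , y) = (2cy / (y - 1) , c(1 + y) / (x(1 - y))).  Wherever the denominators do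
-- not vanish, each claim (φ lands on the Edwards curve with d = 4c + 1 = 16b + 1,
-- ψ lands on the Kubert curve, ψ ∘ φ = id, φ ∘ ψ = id) follows because D·(lhs - rhs)
-- is an explicit polynomial combination of the defining equations, for a product D
-- of nonzero denominators.  The point (0 , c) ↦ (1 , 0) shows that the composites
-- are defined somewhere; it needs c ≠ 0 and 2c ≠ 0, i.e. b ≠ 0 and char K ≠ 2.

open import Defs
open import Data.Product using (_×_; _,_)
open import Relation.Nullary using (¬_; yes; no)
open import Data.Nat.Base as ℕ using (ℕ; zero; suc)
import Data.Nat.Properties as ℕ
open import Data.Integer.Base as ℤ using (ℤ; +_; -[1+_]; _⊖_; +-*-rawRing)
import Data.Integer.Properties as ℤ
open import Data.Maybe.Base using (Maybe; just; nothing)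
import Relation.Binary.PropositionalEquality as ≡
open import Algebra.Bundles using (CommutativeRing)
open import Algebra.Morphism.Structures using (module RingMorphisms)
import Algebra.Morphism.Construct.Identity as Identity
open import Algebra.Solver.Ring.AlmostCommutativeRing
  using (_-Raw-AlmostCommutative⟶_; fromCommutativeRing)

-- The equality of a field is not decidable, so the ring solver normalises with
-- integer coefficients, transported along the canonical map ℤ → R.
module IntegerCoefficientRingSolver {a ℓ} (R : CommutativeRing a ℓ) where
  open CommutativeRing R
  open import Algebra.Properties.Ring ring using (-0#≈0#; -‿distribˡ-*; -‿distribʳ-*; -‿involutive)
  open import Algebra.Properties.AbelianGroup +-abelianGroup using (⁻¹-∙-comm)
  open import Algebra.Properties.Semiring.Mult.TCOptimised semiring
    using (1+×; ×-homo-+; ×1-homo-*) renaming (_×_ to _×′_)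
  open import Relation.Binary.Reasoning.Setoid setoid

  fromℤ : ℤ → Carrier
  fromℤ (+ n)    = n ×′ 1#
  fromℤ -[1+ n ] = - (suc n ×′ 1#)

  private
    cancel-1# : ∀ x y → (1# + x) + - (1# + y) ≈ x + - y
    cancel-1# x y = begin
      (1# + x) + - (1# + y)     ≈⟨ +-cong (+-comm x 1#) (⁻¹-∙-comm 1# y) ⟨
      (x + 1#) + (- 1# + - y)   ≈⟨ +-assoc x 1# _ ⟩
      x + (1# + (- 1# + - y))   ≈⟨ +-congˡ (+-assoc 1# _ _) ⟨
      x + ((1# + - 1#) + - y)   ≈⟨ +-congˡ (+-congʳ (-‿inverseʳ 1#)) ⟩
      x + (0# + - y)            ≈⟨ +-congˡ (+-identityˡ _) ⟩
      x + - y                   ∎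

  fromℤ-⊖ : ∀ m n → fromℤ (m ⊖ n) ≈ m ×′ 1# + - (n ×′ 1#)
  fromℤ-⊖ m       zero    = sym (trans (+-congˡ -0#≈0#) (+-identityʳ _))
  fromℤ-⊖ zero    (suc n) = sym (+-identityˡ _)
  fromℤ-⊖ (suc m) (suc n) = begin
    fromℤ (suc m ⊖ suc n)                ≡⟨ ≡.cong fromℤ (ℤ.[1+m]⊖[1+n]≡m⊖n m n) ⟩
    fromℤ (m ⊖ n)                        ≈⟨ fromℤ-⊖ m n ⟩
    m ×′ 1# + - (n ×′ 1#)                ≈⟨ cancel-1# _ _ ⟨
    (1# + m ×′ 1#) + - (1# + n ×′ 1#)    ≈⟨ +-cong (1+× m 1#) (-‿cong (1+× n 1#)) ⟨
    suc m ×′ 1# + - (suc n ×′ 1#)        ∎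

  fromℤ-+ : ∀ i j → fromℤ (i ℤ.+ j) ≈ fromℤ i + fromℤ j
  fromℤ-+ (+ m)    (+ n)    = ×-homo-+ 1# m n
  fromℤ-+ (+ m)    -[1+ n ] = fromℤ-⊖ m (suc n)
  fromℤ-+ -[1+ m ] (+ n)    = trans (fromℤ-⊖ n (suc m)) (+-comm _ _)
  fromℤ-+ -[1+ m ] -[1+ n ] = begin
    - (suc (suc (m ℕ.+ n)) ×′ 1#)        ≡⟨ ≡.cong (λ k → - (suc k ×′ 1#)) (ℕ.+-suc m n) ⟨
    - ((suc m ℕ.+ suc n) ×′ 1#)          ≈⟨ -‿cong (×-homo-+ 1# (suc m) (suc n)) ⟩
    - (suc m ×′ 1# + suc n ×′ 1#)        ≈⟨ ⁻¹-∙-comm _ _ ⟨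
    - (suc m ×′ 1#) + - (suc n ×′ 1#)    ∎

  private
    fromℤ-+*- : ∀ m n → fromℤ (+ m ℤ.* -[1+ n ]) ≈ fromℤ (+ m) * fromℤ -[1+ n ]
    fromℤ-+*- zero    n = sym (zeroˡ _)
    fromℤ-+*- (suc m) n = trans (-‿cong (×1-homo-* (suc m) (suc n))) (-‿distribʳ-* _ _)

  fromℤ-* : ∀ i j → fromℤ (i ℤ.* j) ≈ fromℤ i * fromℤ j
  fromℤ-* (+ m)    (+ n)    = trans (reflexive (≡.cong fromℤ (ℤ.+◃n≡+n (m ℕ.* n)))) (×1-homo-* m n)
  fromℤ-* (+ m)    -[1+ n ] = fromℤ-+*- m n
  fromℤ-* -[1+ m ] (+ n)    = begin
    fromℤ (-[1+ m ] ℤ.* + n)             ≡⟨ ≡.cong fromℤ (ℤ.*-comm -[1+ m ] (+ n)) ⟩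
    fromℤ (+ n ℤ.* -[1+ m ])             ≈⟨ fromℤ-+*- n m ⟩
    fromℤ (+ n) * fromℤ -[1+ m ]         ≈⟨ *-comm _ _ ⟩
    fromℤ -[1+ m ] * fromℤ (+ n)         ∎
  fromℤ-* -[1+ m ] -[1+ n ] = begin
    (suc m ℕ.* suc n) ×′ 1#              ≈⟨ ×1-homo-* (suc m) (suc n) ⟩
    suc m ×′ 1# * suc n ×′ 1#            ≈⟨ -‿involutive _ ⟨
    - - (suc m ×′ 1# * suc n ×′ 1#)      ≈⟨ -‿cong (-‿distribʳ-* _ _) ⟩
    - (suc m ×′ 1# * - (suc n ×′ 1#))    ≈⟨ -‿distribˡ-* _ _ ⟩
    - (suc m ×′ 1#) * - (suc n ×′ 1#)    ∎

  fromℤ-neg : ∀ i → fromℤ (ℤ.- i) ≈ - fromℤ i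
  fromℤ-neg (+ zero)  = sym -0#≈0#
  fromℤ-neg (+ suc n) = refl
  fromℤ-neg -[1+ n ]  = sym (-‿involutive _)

  fromℤ-homomorphism : +-*-rawRing -Raw-AlmostCommutative⟶ fromCommutativeRing R
  fromℤ-homomorphism = record
    { ⟦_⟧ = fromℤ ; +-homo = fromℤ-+ ; *-homo = fromℤ-* ; -‿homo = fromℤ-neg
    ; 0-homo = refl ; 1-homo = refl }

  private
    fromℤ-equal? : ∀ i j → Maybe (fromℤ i ≈ fromℤ j)
    fromℤ-equal? i j with i ℤ.≟ j
    ... | yes ≡.refl = just refl
    ... | no _       = nothing

  open import Algebra.Solver.Ring +-*-rawRing (fromCommutativeRing R) fromℤ-homomorphism fromℤ-equal? public

module FieldProperties {a ℓ} (F : Field a ℓ) where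
  open Field F
  open import Relation.Binary.Reasoning.Setoid setoid

  *-cancelˡ : ∀ {x y z} → ¬ x ≈ 0# → x * y ≈ x * z → y ≈ z
  *-cancelˡ {x} {y} {z} x≉0 xy≈xz with inverse x x≉0
  ... | w , xw≈1 = begin
    y                ≈⟨ undo y ⟩
    w * (x * y)      ≈⟨ *-congˡ xy≈xz ⟩
    w * (x * z)      ≈⟨ undo z ⟨
    z                ∎
    where
    undo : ∀ u → u ≈ w * (x * u)
    undo u = begin
      u              ≈⟨ *-identityˡ u ⟨
      1# * u         ≈⟨ *-congʳ (trans (sym xw≈1) (*-comm x w)) ⟩
      (w * x) * u    ≈⟨ *-assoc w x u ⟩
      w * (x * u)    ∎

  x≉0∧y≉0⇒x*y≉0 : ∀ {x y} → ¬ x ≈ 0# → ¬ y ≈ 0# → ¬ x * y ≈ 0#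
  x≉0∧y≉0⇒x*y≉0 x≉0 y≉0 xy≈0 = y≉0 (*-cancelˡ x≉0 (trans xy≈0 (sym (zeroʳ _))))

  x≈y*z∧x≉0⇒z≉0 : ∀ {x y z} → x ≈ y * z → ¬ x ≈ 0# → ¬ z ≈ 0#
  x≈y*z∧x≉0⇒z≉0 {y = y} x≈yz x≉0 z≈0 = x≉0 (trans x≈yz (trans (*-congˡ z≈0) (zeroʳ y)))

  x+x≉0 : ¬ 1# + 1# ≈ 0# → ∀ {x} → ¬ x ≈ 0# → ¬ x + x ≈ 0#
  x+x≉0 2≉0 {x} x≉0 x+x≈0 = x≉0∧y≉0⇒x*y≉0 2≉0 x≉0 (begin
    (1# + 1#) * x     ≈⟨ distribʳ x 1# 1# ⟩
    1# * x + 1# * x   ≈⟨ +-cong (*-identityˡ x) (*-identityˡ x) ⟩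
    x + x             ≈⟨ x+x≈0 ⟩
    0#                ∎)

  cancel-combination : ∀ {D u v e} → ¬ D ≈ 0# → D * u ≈ D * v + e → e ≈ 0# → u ≈ v
  cancel-combination {D} {v = v} D≉0 Du≈Dv+e e≈0 =
    *-cancelˡ D≉0 (trans Du≈Dv+e (trans (+-congˡ e≈0) (+-identityʳ (D * v))))

  x≈0∧y≈0⇒x+y≈0 : ∀ {x y} → x ≈ 0# → y ≈ 0# → x + y ≈ 0#
  x≈0∧y≈0⇒x+y≈0 x≈0 y≈0 = trans (+-cong x≈0 y≈0) (+-identityʳ 0#)

  k*[l-r]≈0 : ∀ {l r} k → l ≈ r → k * (l + - r) ≈ 0#
  k*[l-r]≈0 {r = r} k l≈r = trans (*-congˡ (trans (+-congʳ l≈r) (-‿inverseʳ r))) (zeroʳ k)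

  -- The identity is a polynomial identity (proved by the ring solver): the hypotheses
  -- l ≈ r enter only through the factors l + - r.
  ≈-by-certificate₂ : ∀ {D u v k₁ l₁ r₁ k₂ l₂ r₂} → ¬ D ≈ 0# →
                      D * u ≈ D * v + (k₁ * (l₁ + - r₁) + k₂ * (l₂ + - r₂)) →
                      l₁ ≈ r₁ → l₂ ≈ r₂ → u ≈ v
  ≈-by-certificate₂ {k₁ = k₁} {k₂ = k₂} D≉0 identity h₁ h₂ =
    cancel-combination D≉0 identity (x≈0∧y≈0⇒x+y≈0 (k*[l-r]≈0 k₁ h₁) (k*[l-r]≈0 k₂ h₂))

  ≈-by-certificate₃ : ∀ {D u v k₁ l₁ r₁ k₂ l₂ r₂ k₃ l₃ r₃} → ¬ D ≈ 0# →
                      D * u ≈ D * v + (k₁ * (l₁ + - r₁) + (k₂ * (l₂ + - r₂) + k₃ * (l₃ + - r₃))) →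
                      l₁ ≈ r₁ → l₂ ≈ r₂ → l₃ ≈ r₃ → u ≈ v
  ≈-by-certificate₃ {k₁ = k₁} {k₂ = k₂} {k₃ = k₃} D≉0 identity h₁ h₂ h₃ =
    cancel-combination D≉0 identity
      (x≈0∧y≈0⇒x+y≈0 (k*[l-r]≈0 k₁ h₁) (x≈0∧y≈0⇒x+y≈0 (k*[l-r]≈0 k₂ h₂) (k*[l-r]≈0 k₃ h₃)))

-- c plays the role of 4b, so that the Edwards parameter 16b + 1 is 4c + 1.
module KubertEdwardsCorrespondence {a ℓ} (F : Field a ℓ) (c : Field.Carrier F) where
  open Field F
  open FieldProperties F
  open IntegerCoefficientRingSolver commutativeRing using (solve; _:=_; con; _:+_; _:*_; :-_; _:-_)

  private
    infixl 7 _⊛_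
    _⊛_ : ∀ {x y} → ¬ x ≈ 0# → ¬ y ≈ 0# → ¬ x * y ≈ 0#
    _⊛_ = x≉0∧y≉0⇒x*y≉0

  OnKubert : Carrier → Carrier → Set ℓ
  OnKubert u v = v * v ≈ (u + - c) * (u * u + u + - c)

  OnEdwards : Carrier → Carrier → Set ℓ
  OnEdwards x y = x * x + y * y ≈ 1# + (c + c + c + c + 1#) * x * x * y * y

  Φ-Sends : Carrier → Carrier → Carrier → Carrier → Set ℓ
  Φ-Sends u v x y =
    ¬ v ≈ 0# × ¬ u + - (c + c) ≈ 0# × x * v ≈ c + - u × y * (u + - (c + c)) ≈ u

  Ψ-Sends : Carrier → Carrier → Carrier → Carrier → Set ℓ
  Ψ-Sends x y u v =
    ¬ y + - 1# ≈ 0# × ¬ x * (1# + - y) ≈ 0# ×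
    u * (y + - 1#) ≈ (c + c) * y × v * (x * (1# + - y)) ≈ c * (1# + y)

  Φ-onEdwards : ∀ {u v x y} → OnKubert u v → Φ-Sends u v x y → OnEdwards x y
  Φ-onEdwards {u} {v} {x} {y} onK (v≉0 , q≉0 , x-eq , y-eq) =
    ≈-by-certificate₃ (v≉0 ⊛ v≉0 ⊛ (q≉0 ⊛ q≉0))
      (solve 5 (λ c u v x y →
        let q = u :- (c :+ c)
            p = c :- u
            d = c :+ c :+ c :+ c :+ con (+ 1)
            D = v :* v :* (q :* q)
        in D :* (x :* x :+ y :* y) := D :* (con (+ 1) :+ d :* x :* x :* y :* y)
           :+ ((q :* q :- d :* u :* u) :* (x :* v :+ p) :* (x :* v :- p)
           :+ ((v :* v :- d :* x :* x :* v :* v) :* (y :* q :+ u) :* (y :* q :- u)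
           :+ (u :* u :- q :* q) :* (v :* v :- (u :- c) :* (u :* u :+ u :- c)))))
        refl c u v x y)
      x-eq y-eq onK

  Ψ-onKubert : ∀ {x y u v} → OnEdwards x y → Ψ-Sends x y u v → OnKubert u v
  Ψ-onKubert {x} {y} {u} {v} onE (s≉0 , t≉0 , u-eq , v-eq) =
    ≈-by-certificate₃ (t≉0 ⊛ t≉0 ⊛ s≉0 ⊛ (s≉0 ⊛ s≉0))
      (solve 5 (λ c x y u v →
        let s = y :- con (+ 1)
            t = x :* (con (+ 1) :- y)
            m = u :* s
            M = (c :+ c) :* y
            n = v :* t
            N = c :* (con (+ 1) :+ y)
            Q = m :* m :+ m :* M :+ M :* M :+ (s :- c :* s) :* (m :+ M) :- (c :+ c) :* s :* s
            d = c :+ c :+ c :+ c :+ con (+ 1)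
            D = t :* t :* s :* (s :* s)
        in D :* (v :* v) := D :* ((u :- c) :* (u :* u :+ u :- c))
           :+ (s :* s :* s :* (n :+ N) :* (n :- N)
           :+ ((:- (t :* t :* Q)) :* (m :- M)
           :+ c :* c :* s :* s :* (con (+ 1) :+ y) :* (x :* x :+ y :* y :- (con (+ 1) :+ d :* x :* x :* y :* y)))))
        refl c x y u v)
      v-eq u-eq onE

  Ψ∘Φ≈id : ∀ {u v x y u₁ v₁} → Φ-Sends u v x y → Ψ-Sends x y u₁ v₁ → u₁ ≈ u × v₁ ≈ v
  Ψ∘Φ≈id {u} {v} {x} {y} {u₁} {v₁} (v≉0 , q≉0 , x-eq , y-eq) (s≉0 , t≉0 , u₁-eq , v₁-eq) =
    ≈-by-certificate₂ (s≉0 ⊛ q≉0)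
      (solve 4 (λ c u y u₁ →
        let q = u :- (c :+ c)
            s = y :- con (+ 1)
        in s :* q :* u₁ := s :* q :* u :+ (q :* (u₁ :* s :- (c :+ c) :* y) :+ (c :+ c :- u) :* (y :* q :- u)))
        refl c u y u₁)
      u₁-eq y-eq ,
    ≈-by-certificate₃ (t≉0 ⊛ v≉0 ⊛ q≉0)
      (solve 6 (λ c u v x y v₁ →
        let q = u :- (c :+ c)
            t = x :* (con (+ 1) :- y)
        in t :* v :* q :* v₁ := t :* v :* q :* v
           :+ (v :* q :* (v₁ :* t :- c :* (con (+ 1) :+ y))
           :+ ((c :* v :+ x :* v :* v) :* (y :* q :- u)
           :+ (c :+ c) :* v :* (x :* v :- (c :- u)))))
        refl c u v x y v₁)
      v₁-eq y-eq x-eq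

  Φ∘Ψ≈id : ∀ {x y u v x₁ y₁} → Ψ-Sends x y u v → Φ-Sends u v x₁ y₁ → x₁ ≈ x × y₁ ≈ y
  Φ∘Ψ≈id {x} {y} {u} {v} {x₁} {y₁} (s≉0 , t≉0 , u-eq , v-eq) (v≉0 , q≉0 , x₁-eq , y₁-eq) =
    ≈-by-certificate₃ (v≉0 ⊛ t≉0 ⊛ s≉0)
      (solve 6 (λ c x y u v x₁ →
        let s = y :- con (+ 1)
            t = x :* (con (+ 1) :- y)
        in v :* t :* s :* x₁ := v :* t :* s :* x
           :+ (t :* s :* (x₁ :* v :- (c :- u))
           :+ (s :* x :* (u :* s :- (c :+ c) :* y)
           :+ (:- (s :* x)) :* (v :* t :- c :* (con (+ 1) :+ y)))))
        refl c x y u v x₁)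
      x₁-eq u-eq v-eq ,
    ≈-by-certificate₂ (s≉0 ⊛ q≉0)
      (solve 4 (λ c y u y₁ →
        let s = y :- con (+ 1)
            q = u :- (c :+ c)
        in s :* q :* y₁ := s :* q :* y :+ (s :* (y₁ :* q :- u) :+ (:- s) :* (u :* s :- (c :+ c) :* y)))
        refl c y u y₁)
      y₁-eq u-eq

  base-onKubert : OnKubert 0# c
  base-onKubert = solve 1 (λ c → c :* c := (con (+ 0) :- c) :* (con (+ 0) :* con (+ 0) :+ con (+ 0) :- c)) refl c

  base-onEdwards : OnEdwards 1# 0#
  base-onEdwards = solve 1 (λ c →
    con (+ 1) :* con (+ 1) :+ con (+ 0) :* con (+ 0)
      := con (+ 1) :+ (c :+ c :+ c :+ c :+ con (+ 1)) :* con (+ 1) :* con (+ 1) :* con (+ 0) :* con (+ 0)) refl c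

  base-Φ : ¬ c ≈ 0# → ¬ c + c ≈ 0# → Φ-Sends 0# c 1# 0#
  base-Φ c≉0 2c≉0 =
      c≉0
    , x≈y*z∧x≉0⇒z≉0 (solve 1 (λ c → c :+ c := (:- con (+ 1)) :* (con (+ 0) :- (c :+ c))) refl c) 2c≉0
    , solve 1 (λ c → con (+ 1) :* c := c :- con (+ 0)) refl c
    , solve 1 (λ c → con (+ 0) :* (con (+ 0) :- (c :+ c)) := con (+ 0)) refl c

  base-Ψ : Ψ-Sends 1# 0# 0# c
  base-Ψ =
      x≈y*z∧x≉0⇒z≉0 (solve 0 (con (+ 1) := (:- con (+ 1)) :* (con (+ 0) :- con (+ 1))) refl) 1≉0
    , x≈y*z∧x≉0⇒z≉0 (solve 0 (con (+ 1) := con (+ 1) :* (con (+ 1) :* (con (+ 1) :- con (+ 0)))) refl) 1≉0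
    , solve 1 (λ c → con (+ 0) :* (con (+ 0) :- con (+ 1)) := (c :+ c) :* con (+ 0)) refl c
    , solve 1 (λ c → c :* (con (+ 1) :* (con (+ 1) :- con (+ 0))) := c :* (con (+ 1) :+ con (+ 0))) refl c
    where
    1≉0 : ¬ 1# ≈ 0#
    1≉0 1≈0 = 0≉1 (sym 1≈0)

module _ {a ℓ} (K : Field a ℓ) (b : Field.Carrier K) where
  open FieldOps K
  open Curves K
  open FieldProperties K using (x+x≉0)
  private module K = Field K

  c : K.Carrier
  c = 4 · b

  d : K.Carrier
  d = 16 · b K.+ K.1#

  φ : RationalMap {K = K}
  φ = record { num₁ = con c ⊕ ⊖ X ; den₁ = Y ; num₂ = X ; den₂ = X ⊕ ⊖ (con c ⊕ con c) }

  ψ : RationalMap {K = K}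
  ψ = record { num₁ = (con c ⊕ con c) ⊗ Y ; den₁ = Y ⊕ ⊖ con K.1#
             ; num₂ = con c ⊗ (con K.1# ⊕ Y) ; den₂ = X ⊗ (con K.1# ⊕ ⊖ Y) }

  open IntegerCoefficientRingSolver K.commutativeRing
    using (Polynomial; solve; _:=_; con; _:+_; _:*_)

  -- con (+ n) denotes the sum n ×′ 1# without a trailing 0#, unlike fromℕ n in n · b;
  -- numeral n evaluates to fromℕ n on the nose.
  numeral : ∀ {n} → ℕ → Polynomial n
  numeral zero    = con (+ 0)
  numeral (suc k) = con (+ 1) :+ numeral k

  d≈4c+1 : d K.≈ c K.+ c K.+ c K.+ c K.+ K.1#
  d≈4c+1 = solve 1 (λ b → numeral 16 :* b :+ con (+ 1)
                         := numeral 4 :* b :+ numeral 4 :* b :+ numeral 4 :* b :+ numeral 4 :* b :+ con (+ 1))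
             K.refl b

  Nondegenerate : Set ℓ
  Nondegenerate = ¬ b ^ 4 K.* (K.1# K.+ 16 · b) K.≈ K.0#

  c≉0 : CharNot2 → Nondegenerate → ¬ c K.≈ K.0#
  c≉0 2≉0 nondegenerate c≈0 = x+x≉0 2≉0 (x+x≉0 2≉0 b≉0) (K.trans (K.sym c≈4b) c≈0)
    where
    b≉0 : ¬ b K.≈ K.0#
    b≉0 b≈0 = nondegenerate (K.trans (K.*-congʳ (K.trans (K.*-congʳ b≈0) (K.zeroˡ _))) (K.zeroˡ _))
    c≈4b : c K.≈ (b K.+ b) K.+ (b K.+ b)
    c≈4b = solve 1 (λ b → numeral 4 :* b := (b :+ b) :+ (b :+ b)) K.refl b

  c+c≉0 : CharNot2 → Nondegenerate → ¬ c K.+ c K.≈ K.0#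
  c+c≉0 2≉0 nondegenerate = x+x≉0 2≉0 (c≉0 2≉0 nondegenerate)

  module AtExtension (E : Extension K) where
    open Extension E
    open Field L
    open RingMorphisms K.rawRing rawRing using (IsRingHomomorphism)
    open IsRingHomomorphism isHom using (⟦⟧-cong; +-homo; 1#-homo)
    open KubertEdwardsCorrespondence L (ι c) public

    ι-d : ι d ≈ ι c + ι c + ι c + ι c + 1#
    ι-d = trans (⟦⟧-cong d≈4c+1)
      (trans (+-homo _ _) (+-cong (trans (+-homo _ _) (+-congʳ (trans (+-homo _ _) (+-congʳ (+-homo _ _))))) 1#-homo))

    edwards-rhs : ∀ x y → ι K.1# + ι d * x * x * y * y ≈ 1# + (ι c + ι c + ι c + ι c + 1#) * x * x * y * y
    edwards-rhs x y = +-cong 1#-homo (*-congʳ (*-congʳ (*-congʳ (*-congʳ ι-d))))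

    onEdwards⇒onCurve : ∀ {x y} → OnEdwards x y → OnCurve (Edwards d) E x y
    onEdwards⇒onCurve {x} {y} onE = trans onE (sym (edwards-rhs x y))

    onCurve⇒onEdwards : ∀ {x y} → OnCurve (Edwards d) E x y → OnEdwards x y
    onCurve⇒onEdwards {x} {y} onC = trans onC (edwards-rhs x y)

    sends-ψ⇒Ψ-Sends : ∀ {x y u v} → Sends ψ E x y u v → Ψ-Sends x y u v
    sends-ψ⇒Ψ-Sends (s≉0 , t≉0 , u-eq , v-eq) =
        (λ s≈0 → s≉0 (trans s≈ s≈0))
      , (λ t≈0 → t≉0 (trans t≈ t≈0))
      , trans (*-congˡ (sym s≈)) u-eq
      , trans (*-congˡ (sym t≈)) (trans v-eq (*-congˡ (+-congʳ 1#-homo)))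
      where
      s≈ : ∀ {y} → y + - ι K.1# ≈ y + - 1#
      s≈ = +-congˡ (-‿cong 1#-homo)
      t≈ : ∀ {x y} → x * (ι K.1# + - y) ≈ x * (1# + - y)
      t≈ = *-congˡ (+-congʳ 1#-homo)

  open AtExtension

  trivialExtension : Extension K
  trivialExtension = record
    { L = K ; ι = λ x → x ; isHom = Identity.isRingHomomorphism K.rawRing K.refl }

  kubert⇢edwards : CharNot2 → Nondegenerate → IsLeftInverseOn (Kubert b) (Edwards d) φ ψ
  kubert⇢edwards 2≉0 nondegenerate =
      (λ E _ _ _ _ onK φ-sends → onEdwards⇒onCurve E (Φ-onEdwards E onK φ-sends))
    , (λ E _ _ _ _ _ _ _ φ-sends ψ-sends → Ψ∘Φ≈id E φ-sends (sends-ψ⇒Ψ-Sends E ψ-sends))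
    , (trivialExtension , K.0# , c , K.1# , K.0# , K.0# , c
      , base-onKubert trivialExtension
      , base-Φ trivialExtension (c≉0 2≉0 nondegenerate) (c+c≉0 2≉0 nondegenerate)
      , base-Ψ trivialExtension)

  edwards⇢kubert : CharNot2 → Nondegenerate → IsLeftInverseOn (Edwards d) (Kubert b) ψ φ
  edwards⇢kubert 2≉0 nondegenerate =
      (λ E _ _ _ _ onE ψ-sends → Ψ-onKubert E (onCurve⇒onEdwards E onE) (sends-ψ⇒Ψ-Sends E ψ-sends))
    , (λ E _ _ _ _ _ _ _ ψ-sends φ-sends → Φ∘Ψ≈id E (sends-ψ⇒Ψ-Sends E ψ-sends) φ-sends)
    , (trivialExtension , K.1# , K.0# , K.0# , c , K.1# , K.0#
      , onEdwards⇒onCurve trivialExtension (base-onEdwards trivialExtension)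
      , base-Ψ trivialExtension
      , base-Φ trivialExtension (c≉0 2≉0 nondegenerate) (c+c≉0 2≉0 nondegenerate))

proposition5 : ∀ {c ℓ} (K : Field c ℓ) →
  let open Field K
      open FieldOps K
      open Curves K
  in
  CharNot2 → (b : Carrier) → ¬ (b ^ 4 * (1# + 16 · b) ≈ 0#) →
  BirationallyEquivalent (Kubert b) (Edwards (16 · b + 1#))
  × (¬ IsSquare (16 · b + 1#) → IsCompleteEdwards (16 · b + 1#))
proposition5 K 2≉0 b nondegenerate =
    (φ K b , ψ K b , kubert⇢edwards K b 2≉0 nondegenerate , edwards⇢kubert K b 2≉0 nondegenerate)
  , λ d-nonsquare → d-nonsquare
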